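{- Let $p_1<p_2<\cdots<p_k$ be distinct primes and let $m$ be a positive integer such that \[\sum_{i=1}^k\frac1{p_i}=1-\frac1m.\] Then $m=p_1p_2\cdots p_k$. Consequently $N=p_1p_2\cdots p_k$ is a primary pseudoperfect number, i.e. $\frac1N+\sum_{p\mid N}\frac1p=1$.
   Context: A squarefree positive integer $n$ is a primary pseudoperfect number if $\frac1n+\sum_{p\mid n}\frac1p=1$, the sum running over the prime divisors of $n$. -}

module Defs where

open import Data.Nat using (ℕ; zero; suc; _*_; _<_)
open import Data.Nat.Divisibility using (_∣_)
open import Data.Nat.Primality using (Prime)
open import Data.Integer using (+_)
open import Data.Rational using (ℚ; _/_; 0ℚ; _+_)
open import Data.List using (List; []; _∷_; foldr; map; filter; upTo)
open import Relation.Nullary using (¬_)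
open import Data.Product using (_×_)
open import Relation.Binary.PropositionalEquality using (_≡_)
open import Data.Nat.Divisibility using (_∣?_)
open import Data.Nat.Primality using (prime?)
open import Data.Rational using (1ℚ)

-- 1/n as a rational; the value at 0 is a junk value 0 (never used: all
-- arguments below are primes or positive integers).
recip : ℕ → ℚ
recip zero    = 0ℚ
recip (suc n) = + 1 / suc n

sumℚ : List ℚ → ℚ
sumℚ = foldr _+_ 0ℚ

SquareFree : ℕ → Set
SquareFree n = ∀ d → 1 < d → ¬ (d * d ∣ n)

primeDivisors : ℕ → List ℕ
primeDivisors n = filter (λ p → prime? p) (filter (λ p → p ∣? n) (upTo (suc n)))

PrimaryPseudoperfect : ℕ → Set
PrimaryPseudoperfect n =
  0 < n × SquareFree n × (recip n + sumℚ (map recip (primeDivisors n)) ≡ 1ℚ)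

{-# OPTIONS --safe #-}
-- Write P = p₁⋯pₖ and S = Σᵢ P/pᵢ. Multiplying the hypothesis by P·m gives
-- S·m + P = P·m, so m ∣ P; with P = k·m this becomes S + k = P, hence k
-- divides both P and S. But S ≡ P/pᵢ ≢ 0 (mod pᵢ) for each i, so P and S are
-- coprime, k = 1 and m = P. Being a product of distinct primes, P is
-- squarefree and its prime divisors are exactly p₁, …, pₖ, which turns the
-- hypothesis into 1/P + Σ_{p ∣ P} 1/p = 1.
module Submission where

open import Defs
open import Data.Nat using (ℕ; _<_)
open import Data.Nat.Primality using (Prime)
open import Data.List using (List; map)
open import Data.Nat.ListAction using (product)
open import Data.List.Relation.Unary.All using (All)
open import Data.List.Relation.Unary.Linked using (Linked)
open import Data.Rational using (_-_; 1ℚ)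
open import Data.Product using (_×_)
open import Relation.Binary.PropositionalEquality using (_≡_)

open import Data.Nat as ℕ using (zero; suc; s≤s; z≤n; _+_; _*_; NonZero; >-nonZero)
import Data.Nat.Properties as ℕ
open import Data.Nat.Divisibility
open import Data.Nat.Coprimality using (Coprime; coprime-divisor)
open import Data.Nat.Primality
  using (prime?; prime[2]; ¬prime[1]; prime⇒irreducible; prime⇒nonZero; euclidsLemma;
         productOfPrimes≢0; productOfPrimes≥1)
open import Data.Nat.Primality.Factorisation using (factorise; factorisationHasAllPrimeFactors)
open import Data.Nat.ListAction.Properties using (∈⇒∣product)
open import Data.Integer as ℤ using (+_)
import Data.Integer.Properties as ℤ
open import Data.Rational as ℚ using (ℚ; ↥_)
import Data.Rational.Properties as ℚ
open import Data.Rational.Literals using (fromℤ)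
open import Data.Rational.Solver using (module +-*-Solver)
open import Algebra.Properties.Group ℚ.+-0-group using (//-rightDividesˡ)
open import Data.List using ([]; _∷_; upTo)
open import Data.List.Membership.Propositional using (_∈_)
open import Data.List.Membership.Propositional.Properties using (∈-filter⁺; ∈-filter⁻; ∈-upTo⁺)
open import Data.List.Membership.Propositional.Properties.WithK using (unique∧set⇒bag)
open import Data.List.Relation.Unary.Any using (here; there)
open import Data.List.Relation.Unary.All as All using ([]; _∷_)
open import Data.List.Relation.Unary.All.Properties using (All¬⇒¬Any)
open import Data.List.Relation.Unary.AllPairs as AllPairs using ()
open import Data.List.Relation.Unary.Unique.Propositional using (Unique; _∷_)
open import Data.List.Relation.Unary.Linked as Linked using ()
open import Data.List.Relation.Unary.Linked.Properties using (Linked⇒AllPairs; filter⁺; applyUpTo⁺₂)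
open import Data.List.Relation.Unary.Sorted.TotalOrder.Properties using (↗↭↗⇒≋)
open import Data.List.Relation.Binary.Equality.Propositional using (≋⇒≡)
open import Data.List.Relation.Binary.Permutation.Propositional using (↭⇒↭ₛ)
open import Data.List.Relation.Binary.BagAndSetEquality using (∼bag⇒↭)
open import Data.Product using (_,_; ∃-syntax)
open import Data.Sum using (inj₁; inj₂; [_,_]′)
open import Data.Empty using (⊥; ⊥-elim)
open import Function using (id; mk⇔)
open import Relation.Binary.PropositionalEquality
  using (refl; sym; trans; cong; cong₂; subst; module ≡-Reasoning)

fromℕ : ℕ → ℚ
fromℕ n = fromℤ (+ n)

fromℕ-injective : ∀ {m n} → fromℕ m ≡ fromℕ n → m ≡ n
fromℕ-injective eq = ℤ.+-injective (cong ↥_ eq)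

-- fromℕ n has denominator 1 by definition, so both sides are fractions over 1
-- and ↥p/↧p≡p, /-cong reduce the claim to ℤ.
fromℕ-homo-+ : ∀ m n → fromℕ (m + n) ≡ fromℕ m ℚ.+ fromℕ n
fromℕ-homo-+ m n = trans (sym (ℚ.↥p/↧p≡p (fromℕ (m + n))))
  (ℚ./-cong (trans (ℤ.pos-+ m n) (sym (cong₂ ℤ._+_ (ℤ.*-identityʳ (+ m)) (ℤ.*-identityʳ (+ n))))) refl)

fromℕ-homo-* : ∀ m n → fromℕ (m * n) ≡ fromℕ m ℚ.* fromℕ n
fromℕ-homo-* m n = trans (sym (ℚ.↥p/↧p≡p (fromℕ (m * n)))) (ℚ./-cong (ℤ.pos-* m n) refl)

recip*fromℕ≡1 : ∀ n .{{_ : NonZero n}} → recip n ℚ.* fromℕ n ≡ 1ℚ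
recip*fromℕ≡1 (suc k) = trans (cong (ℚ._* fromℕ (suc k)) (ℚ.↥p/↧p≡p (ℚ.1/ fromℕ (suc k))))
                              (ℚ.*-inverseˡ (fromℕ (suc k)))

-- cofactorSum ps = Σ_{p ∈ ps} ∏_{q ∈ ps, q ≠ p} q
cofactorSum : List ℕ → ℕ
cofactorSum []       = 0
cofactorSum (p ∷ ps) = product ps + p * cofactorSum ps

sum-recip*product≡cofactorSum : ∀ {ps} → All NonZero ps →
  sumℚ (map recip ps) ℚ.* fromℕ (product ps) ≡ fromℕ (cofactorSum ps)
sum-recip*product≡cofactorSum {[]}     []           = refl
sum-recip*product≡cofactorSum {p ∷ ps} (p≢0 ∷ ps≢0) = begin
  (r ℚ.+ σ) ℚ.* fromℕ (p * P)
    ≡⟨ cong ((r ℚ.+ σ) ℚ.*_) (fromℕ-homo-* p P) ⟩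
  (r ℚ.+ σ) ℚ.* (fromℕ p ℚ.* fromℕ P)
    ≡⟨ solve 4 (λ r σ x y → (r :+ σ) :* (x :* y) := r :* x :* y :+ x :* (σ :* y))
             refl r σ (fromℕ p) (fromℕ P) ⟩
  r ℚ.* fromℕ p ℚ.* fromℕ P ℚ.+ fromℕ p ℚ.* (σ ℚ.* fromℕ P)
    ≡⟨ cong₂ (λ a b → a ℚ.* fromℕ P ℚ.+ fromℕ p ℚ.* b)
             (recip*fromℕ≡1 p {{p≢0}}) (sum-recip*product≡cofactorSum ps≢0) ⟩
  1ℚ ℚ.* fromℕ P ℚ.+ fromℕ p ℚ.* fromℕ S
    ≡⟨ cong₂ ℚ._+_ (ℚ.*-identityˡ (fromℕ P)) (sym (fromℕ-homo-* p S)) ⟩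
  fromℕ P ℚ.+ fromℕ (p * S)
    ≡⟨ sym (fromℕ-homo-+ P (p * S)) ⟩
  fromℕ (P + p * S)
    ∎
  where
  open ≡-Reasoning
  open +-*-Solver
  r = recip p
  σ = sumℚ (map recip ps)
  P = product ps
  S = cofactorSum ps

clearDenominators : ∀ {ps m} .{{_ : NonZero m}} → All NonZero ps →
  sumℚ (map recip ps) ℚ.+ recip m ≡ 1ℚ →
  cofactorSum ps * m + product ps ≡ product ps * m
clearDenominators {ps} {m} ps≢0 σ+r≡1 = fromℕ-injective (begin
  fromℕ (S * m + P)
    ≡⟨ trans (fromℕ-homo-+ (S * m) P) (cong (ℚ._+ x) (fromℕ-homo-* S m)) ⟩
  fromℕ S ℚ.* y ℚ.+ x
    ≡⟨ cong₂ (λ a b → a ℚ.* y ℚ.+ b) (sym (sum-recip*product≡cofactorSum ps≢0)) (sym r*y*x≡x) ⟩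
  σ ℚ.* x ℚ.* y ℚ.+ r ℚ.* y ℚ.* x
    ≡⟨ solve 4 (λ σ r x y → σ :* x :* y :+ r :* y :* x := (σ :+ r) :* (x :* y)) refl σ r x y ⟩
  (σ ℚ.+ r) ℚ.* (x ℚ.* y)
    ≡⟨ trans (cong (ℚ._* (x ℚ.* y)) σ+r≡1) (ℚ.*-identityˡ (x ℚ.* y)) ⟩
  x ℚ.* y
    ≡⟨ sym (fromℕ-homo-* P m) ⟩
  fromℕ (P * m)
    ∎)
  where
  open ≡-Reasoning
  open +-*-Solver
  S = cofactorSum ps
  P = product ps
  σ = sumℚ (map recip ps)
  r = recip m
  x = fromℕ P
  y = fromℕ m
  r*y*x≡x : r ℚ.* y ℚ.* x ≡ x
  r*y*x≡x = trans (cong (ℚ._* x) (recip*fromℕ≡1 m)) (ℚ.*-identityˡ x)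

coprime∧s*m+n≡n*m⇒m≡n : ∀ {n s m} .{{_ : NonZero m}} → Coprime n s → s * m + n ≡ n * m → m ≡ n
coprime∧s*m+n≡n*m⇒m≡n {n} {s} {m} coprime eq = begin
  m      ≡⟨ sym (ℕ.*-identityˡ m) ⟩
  1 * m  ≡⟨ cong (_* m) (sym (coprime (k∣n , k∣s))) ⟩
  k * m  ≡⟨ sym n≡k*m ⟩
  n      ∎
  where
  open ≡-Reasoning
  m∣n : m ∣ n
  m∣n = ∣m+n∣m⇒∣n (subst (m ∣_) (sym eq) (n∣m*n n)) (n∣m*n s)
  open _∣_ m∣n renaming (quotient to k; equality to n≡k*m)
  s+k≡n : s + k ≡ n
  s+k≡n = ℕ.*-cancelʳ-≡ (s + k) n m (begin
    (s + k) * m    ≡⟨ ℕ.*-distribʳ-+ m s k ⟩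
    s * m + k * m  ≡⟨ cong (λ x → s * m + x) (sym n≡k*m) ⟩
    s * m + n      ≡⟨ eq ⟩
    n * m          ∎)
  k∣n : k ∣ n
  k∣n = divides m (trans n≡k*m (ℕ.*-comm k m))
  k∣s : k ∣ s
  k∣s = ∣m+n∣m⇒∣n (subst (k ∣_) (trans (sym s+k≡n) (ℕ.+-comm s k)) k∣n) ∣-refl

prime∣prime⇒≡ : ∀ {p q} → Prime p → Prime q → p ∣ q → p ≡ q
prime∣prime⇒≡ p-prime q-prime p∣q with prime⇒irreducible q-prime p∣q
... | inj₁ refl = ⊥-elim (¬prime[1] p-prime)
... | inj₂ p≡q = p≡q

∃prime∣ : ∀ {n} → 1 < n → ∃[ q ] Prime q × q ∣ n
∃prime∣ {suc zero} (s≤s ())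
∃prime∣ {suc (suc k)} _ with factorise (suc (suc k))
... | record { factors = [] ; isFactorisation = () }
... | record { factors = q ∷ qs ; isFactorisation = eq ; factorsPrime = q-prime ∷ _ } =
  q , q-prime , divides (product qs) (trans eq (ℕ.*-comm q (product qs)))

¬commonPrime⇒coprime : ∀ {m n} → (∀ {q} → Prime q → q ∣ m → q ∣ n → ⊥) → Coprime m n
¬commonPrime⇒coprime noCommon {zero} (0∣m , 0∣n) =
  ⊥-elim (noCommon prime[2] (∣-trans (2 ∣0) 0∣m) (∣-trans (2 ∣0) 0∣n))
¬commonPrime⇒coprime noCommon {suc zero} _ = refl
¬commonPrime⇒coprime noCommon {suc (suc d)} (d∣m , d∣n) with ∃prime∣ (s≤s (s≤s (z≤n {d})))
... | q , q-prime , q∣d = ⊥-elim (noCommon q-prime (∣-trans q∣d d∣m) (∣-trans q∣d d∣n))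

prime∤cofactorSum : ∀ {q ps} → All Prime ps → Unique ps → q ∈ ps → q ∤ cofactorSum ps
prime∤cofactorSum {q} {q ∷ ps} (q-prime ∷ ps-prime) (q∉ps ∷ _) (here refl) q∣S =
  All¬⇒¬Any q∉ps (factorisationHasAllPrimeFactors q-prime q∣P ps-prime)
  where
  q∣P : q ∣ product ps
  q∣P = ∣m+n∣m⇒∣n (subst (q ∣_) (ℕ.+-comm (product ps) _) q∣S) (m∣m*n (cofactorSum ps))
prime∤cofactorSum {q} {p ∷ ps} (p-prime ∷ ps-prime) (p∉ps ∷ ps-unique) (there q∈ps) q∣S
  with q-prime ← All.lookup ps-prime q∈ps
  with euclidsLemma p (cofactorSum ps) q-prime (∣m+n∣m⇒∣n q∣S (∈⇒∣product q∈ps))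
... | inj₁ q∣p  = All.lookup p∉ps q∈ps (sym (prime∣prime⇒≡ q-prime p-prime q∣p))
... | inj₂ q∣S′ = prime∤cofactorSum ps-prime ps-unique q∈ps q∣S′

coprime-product-cofactorSum : ∀ {ps} → All Prime ps → Unique ps →
  Coprime (product ps) (cofactorSum ps)
coprime-product-cofactorSum ps-prime ps-unique = ¬commonPrime⇒coprime λ q-prime q∣P →
  prime∤cofactorSum ps-prime ps-unique (factorisationHasAllPrimeFactors q-prime q∣P ps-prime)

prime²∤product : ∀ {q ps} → All Prime ps → Unique ps → Prime q → q * q ∤ product ps
prime²∤product {q} {[]} _ _ q-prime q²∣1 =
  ¬prime[1] (subst Prime (∣1⇒≡1 (m*n∣⇒m∣ q q q²∣1)) q-prime)
prime²∤product {q} {p ∷ ps} (p-prime ∷ ps-prime) (p∉ps ∷ ps-unique) q-prime q²∣pP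
  with euclidsLemma p (product ps) q-prime (m*n∣⇒m∣ q q q²∣pP)
... | inj₁ q∣p with refl ← prime∣prime⇒≡ q-prime p-prime q∣p =
  All¬⇒¬Any p∉ps
    (factorisationHasAllPrimeFactors p-prime (*-cancelˡ-∣ p {{prime⇒nonZero p-prime}} q²∣pP) ps-prime)
... | inj₂ q∣P = prime²∤product ps-prime ps-unique q-prime (coprime-divisor q²⊥p q²∣pP)
  where
  q≢p : q ≡ p → ⊥
  q≢p q≡p = All.lookup p∉ps (factorisationHasAllPrimeFactors q-prime q∣P ps-prime) (sym q≡p)
  q²⊥p : Coprime (q * q) p
  q²⊥p = ¬commonPrime⇒coprime λ r-prime r∣q² r∣p → q≢p (trans
    (sym (prime∣prime⇒≡ r-prime q-prime ([ id , id ]′ (euclidsLemma q q r-prime r∣q²))))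
    (prime∣prime⇒≡ r-prime p-prime r∣p))

product-squareFree : ∀ {ps} → All Prime ps → Unique ps → SquareFree (product ps)
product-squareFree ps-prime ps-unique d 1<d d²∣P with ∃prime∣ 1<d
... | q , q-prime , q∣d = prime²∤product ps-prime ps-unique q-prime (∣-trans (*-pres-∣ q∣d q∣d) d²∣P)

strictlySorted⇒unique : ∀ {xs} → Linked _<_ xs → Unique xs
strictlySorted⇒unique xs↗ = AllPairs.map ℕ.<⇒≢ (Linked⇒AllPairs ℕ.<-trans xs↗)

primeDivisors-strictlySorted : ∀ n → Linked _<_ (primeDivisors n)
primeDivisors-strictlySorted n =
  filter⁺ prime? ℕ.<-trans (filter⁺ (_∣? n) ℕ.<-trans (applyUpTo⁺₂ id (suc n) ℕ.n<1+n))

-- Duplicate-free lists with the same elements are permutations of each other,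
-- and sorted permutations coincide.
primeDivisors-product : ∀ {ps} → All Prime ps → Linked _<_ ps → primeDivisors (product ps) ≡ ps
primeDivisors-product {ps} ps-prime ps↗ =
  ≋⇒≡ (↗↭↗⇒≋ ℕ.≤-totalOrder (Linked.map ℕ.<⇒≤ P↗) (Linked.map ℕ.<⇒≤ ps↗) (↭⇒↭ₛ (∼bag⇒↭
    (unique∧set⇒bag (strictlySorted⇒unique P↗) (strictlySorted⇒unique ps↗) (mk⇔ to from)))))
  where
  P = product ps
  P↗ : Linked _<_ (primeDivisors P)
  P↗ = primeDivisors-strictlySorted P
  instance
    P≢0 : NonZero P
    P≢0 = productOfPrimes≢0 ps-prime
  to : ∀ {q} → q ∈ primeDivisors P → q ∈ ps
  to q∈ with q∈P∣ , q-prime ← ∈-filter⁻ prime? q∈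
            with _ , q∣P ← ∈-filter⁻ (_∣? P) {xs = upTo (suc P)} q∈P∣ =
    factorisationHasAllPrimeFactors q-prime q∣P ps-prime
  from : ∀ {q} → q ∈ ps → q ∈ primeDivisors P
  from {q} q∈ps = ∈-filter⁺ prime? (∈-filter⁺ (_∣? P) (∈-upTo⁺ (s≤s (∣⇒≤ q∣P))) q∣P)
                        (All.lookup ps-prime q∈ps)
    where
    q∣P : q ∣ P
    q∣P = ∈⇒∣product q∈ps

mainTheorem1 : (ps : List ℕ) (m : ℕ) → All Prime ps → Linked _<_ ps → 0 < m →
    sumℚ (map recip ps) ≡ 1ℚ - recip m →
    m ≡ product ps × PrimaryPseudoperfect (product ps)
mainTheorem1 ps m ps-prime ps↗ m>0 σ≡1-r =
  m≡P , productOfPrimes≥1 ps-prime , product-squareFree ps-prime ps-unique , pseudoperfect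
  where
  open ≡-Reasoning
  instance
    m≢0 : NonZero m
    m≢0 = >-nonZero m>0
  ps-unique : Unique ps
  ps-unique = strictlySorted⇒unique ps↗
  σ = sumℚ (map recip ps)
  σ+r≡1 : σ ℚ.+ recip m ≡ 1ℚ
  σ+r≡1 = trans (cong (ℚ._+ recip m) σ≡1-r) (//-rightDividesˡ (recip m) 1ℚ)
  m≡P : m ≡ product ps
  m≡P = coprime∧s*m+n≡n*m⇒m≡n (coprime-product-cofactorSum ps-prime ps-unique)
          (clearDenominators (All.map prime⇒nonZero ps-prime) σ+r≡1)
  pseudoperfect : recip (product ps) ℚ.+ sumℚ (map recip (primeDivisors (product ps))) ≡ 1ℚ
  pseudoperfect = begin
    recip (product ps) ℚ.+ sumℚ (map recip (primeDivisors (product ps)))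
      ≡⟨ cong₂ (λ n qs → recip n ℚ.+ sumℚ (map recip qs))
               (sym m≡P) (primeDivisors-product ps-prime ps↗) ⟩
    recip m ℚ.+ σ  ≡⟨ ℚ.+-comm (recip m) σ ⟩
    σ ℚ.+ recip m  ≡⟨ σ+r≡1 ⟩
    1ℚ             ∎
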